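{- Let $n\in\mathbb{N}$ and $a,b\in\mathbb{Z}$ with $\gcd(n,ab)=1$. Then: (1) If $a\equiv b\pmod n$, then $\left(\frac{a}{n}\right)_{2^k}=\left(\frac{b}{n}\right)_{2^k}$ for every $k\in\mathbb{N}_0$. (2) If $k\in\mathbb{N}$ and $\left(\frac{a}{p}\right)_{2^{k-1}}=\left(\frac{b}{p}\right)_{2^{k-1}}=1$ for every prime factor $p$ of $n$, then $\left(\frac{ab}{n}\right)_{2^k}=\left(\frac{a}{n}\right)_{2^k}\cdot\left(\frac{b}{n}\right)_{2^k}$.
   Context: For $k\in\mathbb{N}_0$, a prime $p$ and $a\in\mathbb{Z}$ with $p\nmid a$, $\left(\frac{a}{p}\right)_{2^k}=1$ if there is $x\in\mathbb{Z}$ with $x^{2^k}\equiv a \pmod p$, and $-1$ otherwise. For $n=p_1\cdots p_l$ a product of not necessarily distinct primes with $\gcd(n,a)=1$, $\left(\frac{a}{n}\right)_{2^k}:=\prod_{i=1}^l\left(\frac{a}{p_i}\right)_{2^k}$. -}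

module Defs where

open import Data.Nat as ℕ using (ℕ; zero; suc)
open import Data.Integer as ℤ using (ℤ; +_; -_; _-_; _*_; _^_)
open import Data.Integer.Divisibility using () renaming (_∣_ to _∣ℤ_)
open import Data.Nat.Primality using (Prime)
open import Data.List using (List; []; _∷_)
open import Data.Nat.ListAction using (product)
open import Data.List.Relation.Unary.All using (All)
open import Data.Product using (∃; ∃-syntax; _×_)
open import Data.Sum using (_⊎_)
open import Relation.Nullary using (¬_)
open import Relation.Binary.PropositionalEquality using (_≡_)

_≡_[mod_] : ℤ → ℤ → ℕ → Set
a ≡ b [mod n ] = (+ n) ∣ℤ (a - b)

IsRes : ℕ → ℤ → ℕ → Set
IsRes k a p = ∃[ x ] ((x ^ (2 ℕ.^ k)) ≡ a [mod p ])

-- "(a/p)_{2^k} = s" for a prime p: s = 1 if a is a 2^k-th power residue, s = -1 otherwise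
SymP : ℕ → ℤ → ℕ → ℤ → Set
SymP k a p s = (s ≡ + 1 × IsRes k a p) ⊎ (s ≡ - (+ 1) × ¬ IsRes k a p)

-- "(a/n)_{2^k} = s" where n = p₁⋯pₗ is given by the list [p₁,…,pₗ]:
-- s is the product of the symbols (a/pᵢ)_{2^k}
SymL : ℕ → ℤ → List ℕ → ℤ → Set
SymL k a []       s = s ≡ + 1
SymL k a (p ∷ ps) s = ∃[ t ] ∃[ u ] (SymP k a p t × SymL k a ps u × s ≡ t * u)

IsPrimeFactorization : List ℕ → ℕ → Set
IsPrimeFactorization ps n = All Prime ps × product ps ≡ n

{-# OPTIONS --safe #-}
-- Part (1) holds prime by prime, since whether x ^ 2^k ≡ a (mod p) is solvable depends only on
-- a mod p. For part (2) fix a prime p ∣ n and e = 2^(k-1); among the units mod p let H be the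
-- e-th powers and K ⊆ H the 2e-th powers. Squaring maps H into K and is injective on each of the
-- halves {r : 2r < p} and {r : 2r ≥ p} of the residues, so |H| ≤ 2|K|. If a, b ∈ H ∖ K but
-- ab ∉ K, then K, aK and bK are disjoint subsets of H of size |K| each, so 3|K| ≤ |H|, which is
-- impossible as 1 ∈ K. Hence ab ∈ K exactly when a and b are both or neither in K, which is the
-- multiplicativity of the symbol at p; both parts then multiply over the prime factors of n.
module Submission where

open import Defs
open import Data.Nat as ℕ using (ℕ; zero; suc)
open import Data.Nat.GCD using (gcd)
open import Data.Nat.GCD using (gcd-greatest; module Bézout)
open import Data.Nat.Coprimality using (Coprime; coprime-Bézout)
open import Data.Nat.Divisibility using (_∣_)
open import Data.Nat.Primality using (Prime)
open import Data.Integer as ℤ using (ℤ; _*_; ∣_∣)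
open import Data.List using (List)
open import Data.Product using (_×_)
open import Relation.Binary.PropositionalEquality using (_≡_)

open import Level using (Level; 0ℓ)
open import Data.Nat using (_≤_; _<_; z≤n; s≤s; NonZero)
import Data.Nat.Properties as ℕ
open import Data.Nat.Divisibility using (_∤_; _∣?_; _∣0; >⇒∤; ∣1⇒≡1; divides)
import Data.Nat.Divisibility as ℕ
open import Data.Integer using (+_; -_; _-_; _+_; _^_; 1ℤ)
import Data.Integer.Properties as ℤ
import Data.Integer.Divisibility.Signed as ℤ
open import Data.Integer.DivMod using (_%ℕ_; _/ℕ_; a≡a%ℕn+[a/ℕn]*n; n%ℕd<d)
open import Data.Integer.Tactic.RingSolver using (solve-∀)
import Data.Nat.Tactic.RingSolver as ℕSolver
open import Data.Product using (∃; ∃-syntax; _,_; proj₁; proj₂)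
open import Data.Sum using (_⊎_; inj₁; inj₂; [_,_]′)
import Data.Sum as Sum
open import Data.List using ([]; _∷_)
open import Data.List.Relation.Unary.All using (All; []; _∷_)
import Data.List.Relation.Unary.All as All
open import Data.Nat.ListAction.Properties using (∈⇒∣product)
open import Function using (id; _∘_; flip; _⇔_; mk⇔; Equivalence)
open import Data.Nat.Primality using (euclidsLemma; prime⇒nonZero; prime⇒nonTrivial; prime⇒irreducible)
open import Relation.Nullary using (¬_; Dec; yes; no; ¬?; _×-dec_; contradiction)
open import Relation.Nullary.Decidable using (map′; decidable-stable)
open import Relation.Unary using (Pred; Decidable; _∩_; ∁)
open import Relation.Unary.Properties using (_∩?_; ∁?)
open import Relation.Binary using (Reflexive; Symmetric; Transitive; IsEquivalence; Setoid)
import Relation.Binary.Reasoning.Setoid as SetoidReasoning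
open import Relation.Binary.PropositionalEquality using (refl; sym; trans; cong; cong₂; subst; module ≡-Reasoning)

private variable ℓ ℓ′ : Level

module Counting where

  count : {P : Pred ℕ ℓ} → Decidable P → ℕ → ℕ
  count P? zero = zero
  count P? (suc n) with P? n
  ... | yes _ = suc (count P? n)
  ... | no _ = count P? n

  count-split : {P : Pred ℕ ℓ} {C : Pred ℕ ℓ′} (P? : Decidable P) (C? : Decidable C) →
                ∀ n → count P? n ≡ count (P? ∩? C?) n ℕ.+ count (P? ∩? ∁? C?) n
  count-split P? C? zero = refl
  count-split P? C? (suc n) with P? n | C? n
  ... | yes _ | yes _ = cong suc (count-split P? C? n)
  ... | yes _ | no _ = trans (cong suc (count-split P? C? n)) (sym (ℕ.+-suc _ _))
  ... | no _ | _ = count-split P? C? n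

  count-mono : {P : Pred ℕ ℓ} {Q : Pred ℕ ℓ′} (P? : Decidable P) (Q? : Decidable Q) →
               ∀ {n} → (∀ {i} → i < n → P i → Q i) → count P? n ≤ count Q? n
  count-mono P? Q? {zero} P⇒Q = z≤n
  count-mono P? Q? {suc n} P⇒Q with P? n | Q? n
  ... | yes _ | yes _ = s≤s (count-mono P? Q? (λ i<n → P⇒Q (ℕ.m≤n⇒m≤1+n i<n)))
  ... | yes Pn | no ¬Qn = contradiction (P⇒Q ℕ.≤-refl Pn) ¬Qn
  ... | no _ | yes _ = ℕ.m≤n⇒m≤1+n (count-mono P? Q? (λ i<n → P⇒Q (ℕ.m≤n⇒m≤1+n i<n)))
  ... | no _ | no _ = count-mono P? Q? (λ i<n → P⇒Q (ℕ.m≤n⇒m≤1+n i<n))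

  count-pos : {P : Pred ℕ ℓ} (P? : Decidable P) → ∀ {i n} → i < n → P i → 0 < count P? n
  count-pos P? {i} {suc n} i<1+n Pi with P? n
  ... | yes _ = s≤s z≤n
  ... | no ¬Pn with i ℕ.≟ n
  ...   | yes refl = contradiction Pi ¬Pn
  ...   | no i≢n = count-pos P? (ℕ.≤∧≢⇒< (ℕ.≤-pred i<1+n) i≢n) Pi

  count-delete : {Q : Pred ℕ ℓ} (Q? : Decidable Q) → ∀ {i n} → i < n → Q i →
                 suc (count (Q? ∩? λ j → ¬? (j ℕ.≟ i)) n) ≤ count Q? n
  count-delete Q? {i} {suc n} i<1+n Qi with Q? n | n ℕ.≟ i
  ... | yes _ | no n≢i = s≤s (count-delete Q? (ℕ.≤∧≢⇒< (ℕ.≤-pred i<1+n) (λ i≡n → n≢i (sym i≡n))) Qi)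
  ... | yes _ | yes refl = s≤s (count-mono (Q? ∩? λ j → ¬? (j ℕ.≟ i)) Q? {i} (λ _ → proj₁))
  ... | no ¬Qn | yes refl = contradiction Qi ¬Qn
  ... | no _ | no n≢i = count-delete Q? (ℕ.≤∧≢⇒< (ℕ.≤-pred i<1+n) (λ i≡n → n≢i (sym i≡n))) Qi

  injective⇒count≤ : {P : Pred ℕ ℓ} {Q : Pred ℕ ℓ′} (P? : Decidable P) (Q? : Decidable Q) →
                     ∀ {n m} (f : ℕ → ℕ) →
                     (∀ {i} → i < n → P i → f i < m × Q (f i)) →
                     (∀ {i j} → i < n → j < n → P i → P j → f i ≡ f j → i ≡ j) →
                     count P? n ≤ count Q? m
  injective⇒count≤ P? Q? {zero} f maps inj = z≤n
  injective⇒count≤ {P = P} {Q = Q} P? Q? {suc n} {m} f maps inj with P? n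
  ... | no _ = injective⇒count≤ P? Q? f (λ i<n → maps (ℕ.m≤n⇒m≤1+n i<n))
                 (λ i<n j<n → inj (ℕ.m≤n⇒m≤1+n i<n) (ℕ.m≤n⇒m≤1+n j<n))
  ... | yes Pn = ℕ.≤-trans (s≤s (injective⇒count≤ P? Q∖fn? f maps′ inj′))
                   (count-delete Q? (proj₁ (maps ℕ.≤-refl Pn)) (proj₂ (maps ℕ.≤-refl Pn)))
    where
    Q∖fn? : Decidable (Q ∩ λ j → ¬ j ≡ f n)
    Q∖fn? = Q? ∩? λ j → ¬? (j ℕ.≟ f n)
    maps′ : ∀ {i} → i < n → P i → f i < m × (Q (f i) × ¬ f i ≡ f n)
    maps′ i<n Pi with maps (ℕ.m≤n⇒m≤1+n i<n) Pi
    ... | fi<m , Qfi = fi<m , Qfi , λ fi≡fn → ℕ.<-irrefl (inj (ℕ.m≤n⇒m≤1+n i<n) ℕ.≤-refl Pi Pn fi≡fn) i<n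
    inj′ : ∀ {i j} → i < n → j < n → P i → P j → f i ≡ f j → i ≡ j
    inj′ i<n j<n = inj (ℕ.m≤n⇒m≤1+n i<n) (ℕ.m≤n⇒m≤1+n j<n)

∣∧<⇒≡0 : ∀ {p n} → p ∣ n → n < p → n ≡ 0
∣∧<⇒≡0 {n = zero} _ _ = refl
∣∧<⇒≡0 {n = suc _} p∣n n<p = contradiction p∣n (>⇒∤ n<p)

^-distribʳ-* : ∀ x y n → (x * y) ^ n ≡ x ^ n * y ^ n
^-distribʳ-* x y zero = refl
^-distribʳ-* x y (suc n) = trans (cong (x * y *_) (^-distribʳ-* x y n)) (shuffle x y (x ^ n) (y ^ n))
  where
  shuffle : ∀ x y u v → x * y * (u * v) ≡ x * u * (y * v)
  shuffle = solve-∀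

^-double : ∀ x n → x ^ (2 ℕ.* n) ≡ x ^ n * x ^ n
^-double x n = trans (cong (x ^_) (cong (n ℕ.+_) (ℕ.+-identityʳ n))) (ℤ.^-distribˡ-+-* x n n)

pos-1+*-≡ : ∀ a b c d → 1 ℕ.+ a ℕ.* b ≡ c ℕ.* d → 1ℤ + + a * + b ≡ + c * + d
pos-1+*-≡ a b c d eq = trans (cong (λ t → 1ℤ + t) (sym (ℤ.pos-* a b))) (trans (cong +_ eq) (ℤ.pos-* c d))

∣+⇒+≡ : ∀ {p i j} → 0 < i → i < p → j < p → p ∣ i ℕ.+ j → i ℕ.+ j ≡ p
∣+⇒+≡ {i = i} 0<i _ _ (divides zero i+j≡0) = contradiction (ℕ.m+n≡0⇒m≡0 i i+j≡0) (ℕ.>⇒≢ 0<i)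
∣+⇒+≡ {p} _ _ _ (divides 1 i+j≡p) = trans i+j≡p (ℕ.+-identityʳ p)
∣+⇒+≡ {p} _ i<p j<p (divides (suc (suc k)) i+j≡kp) =
  contradiction (subst (p ℕ.+ p ≤_) (sym i+j≡kp) (ℕ.+-monoʳ-≤ p (ℕ.m≤m+n p _))) (ℕ.<⇒≱ (ℕ.+-mono-< i<p j<p))

module Congruence (p : ℕ) where

  -- A record rather than a synonym for x ≡ y [mod p ], so that x and y stay inferable.
  infix 4 _≈_
  record _≈_ (x y : ℤ) : Set where
    constructor mk≈
    field ≈⇒≡mod : x ≡ y [mod p ]
  open _≈_ public

  ∣ₛ⇒≈ : ∀ {x y} → + p ℤ.∣ x - y → x ≈ y
  ∣ₛ⇒≈ d = mk≈ (ℤ.∣⇒∣ᵤ d)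

  ≈⇒∣ₛ : ∀ {x y} → x ≈ y → + p ℤ.∣ x - y
  ≈⇒∣ₛ (mk≈ d) = ℤ.∣ᵤ⇒∣ d

  ≈-refl : Reflexive _≈_
  ≈-refl {x} = mk≈ (subst (λ z → p ∣ ∣ z ∣) (sym (ℤ.+-inverseʳ x)) (p ∣0))

  ≈-reflexive : ∀ {x y} → x ≡ y → x ≈ y
  ≈-reflexive refl = ≈-refl

  ≈-sym : Symmetric _≈_
  ≈-sym {x} {y} (mk≈ d) = mk≈ (subst (p ∣_) (ℤ.∣i-j∣≡∣j-i∣ x y) d)

  ≈-trans : Transitive _≈_
  ≈-trans {x} {y} {z} x≈y y≈z =
    ∣ₛ⇒≈ (subst (+ p ℤ.∣_) (split x y z) (ℤ.∣m∣n⇒∣m+n (≈⇒∣ₛ x≈y) (≈⇒∣ₛ y≈z)))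
    where
    split : ∀ x y z → (x - y) + (y - z) ≡ x - z
    split = solve-∀

  ≈-isEquivalence : IsEquivalence _≈_
  ≈-isEquivalence = record { refl = ≈-refl ; sym = ≈-sym ; trans = ≈-trans }

  ≈-setoid : Setoid 0ℓ 0ℓ
  ≈-setoid = record { isEquivalence = ≈-isEquivalence }

  module ≈-Reasoning = SetoidReasoning ≈-setoid

  *-cong : ∀ {x y u v} → x ≈ y → u ≈ v → x * u ≈ y * v
  *-cong {x} {y} {u} {v} x≈y u≈v = ∣ₛ⇒≈ (subst (+ p ℤ.∣_) (split x y u v)
    (ℤ.∣m∣n⇒∣m+n (ℤ.∣m⇒∣m*n u (≈⇒∣ₛ x≈y)) (ℤ.∣n⇒∣m*n y (≈⇒∣ₛ u≈v))))
    where
    split : ∀ x y u v → (x - y) * u + y * (u - v) ≡ x * u - y * v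
    split = solve-∀

  *-congˡ : ∀ x {y z} → y ≈ z → x * y ≈ x * z
  *-congˡ x = *-cong (≈-refl {x})

  *-congʳ : ∀ z {x y} → x ≈ y → x * z ≈ y * z
  *-congʳ z x≈y = *-cong x≈y (≈-refl {z})

  ^-cong : ∀ n {x y} → x ≈ y → x ^ n ≈ y ^ n
  ^-cong zero x≈y = ≈-refl
  ^-cong (suc n) x≈y = *-cong x≈y (^-cong n x≈y)

  ∣-resp-≈ : ∀ {x y} → x ≈ y → p ∣ ∣ x ∣ → p ∣ ∣ y ∣
  ∣-resp-≈ {x} {y} x≈y p∣x = ℤ.∣⇒∣ᵤ {+ p} (subst (+ p ℤ.∣_) (cancel x y)
    (ℤ.∣m∣n⇒∣m-n (ℤ.∣ᵤ⇒∣ {+ p} {x} p∣x) (≈⇒∣ₛ x≈y)))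
    where
    cancel : ∀ x y → x - (x - y) ≡ y
    cancel = solve-∀

  ≈? : ∀ x y → Dec (x ≈ y)
  ≈? x y = map′ mk≈ ≈⇒≡mod (p ∣? ∣ x - y ∣)

  ≈⇒≡ : ∀ {x y} → ∣ x - y ∣ < p → x ≈ y → x ≡ y
  ≈⇒≡ {x} {y} small (mk≈ x≈y) = ℤ.i-j≡0⇒i≡j x y (ℤ.∣i∣≡0⇒i≡0 (∣∧<⇒≡0 x≈y small))

  +≈+⇒≡ : ∀ {r s} → r < p → s < p → + r ≈ + s → r ≡ s
  +≈+⇒≡ {r} {s} r<p s<p r≈s = ℤ.+-injective (≈⇒≡ small r≈s)
    where
    small : ∣ + r - + s ∣ < p
    small = ℕ.≤-<-trans (ℕ.≤-reflexive (cong ∣_∣ (ℤ.[+m]-[+n]≡m⊖n r s)))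
              (ℕ.≤-<-trans (ℤ.∣m⊝n∣≤m⊔n r s) (ℕ.⊔-lub r<p s<p))

  %ℕ-≈ : .{{_ : NonZero p}} → ∀ z → + (z %ℕ p) ≈ z
  %ℕ-≈ z = ∣ₛ⇒≈ (ℤ.divides (- (z /ℕ p)) (begin
    + r - z                     ≡⟨ cong (λ t → + r - t) (a≡a%ℕn+[a/ℕn]*n z p) ⟩
    + r - (+ r + z /ℕ p * + p)  ≡⟨ cancel (+ r) (z /ℕ p) (+ p) ⟩
    - (z /ℕ p) * + p            ∎))
    where
    open ≡-Reasoning
    r : ℕ
    r = z %ℕ p
    cancel : ∀ r q p → r - (r + q * p) ≡ - q * p
    cancel = solve-∀

  IsPower : ℕ → ℤ → Set
  IsPower m c = ∃[ x ] (x ^ m ≈ c)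

  IsPower-resp : ∀ m {c d} → c ≈ d → IsPower m c → IsPower m d
  IsPower-resp m c≈d (x , xᵐ≈c) = x , ≈-trans xᵐ≈c c≈d

  IsPower? : .{{NonZero p}} → ∀ m → Decidable (IsPower m)
  IsPower? m c = map′ (λ (r , _ , rᵐ≈c) → + r , rᵐ≈c)
    (λ (x , xᵐ≈c) → x %ℕ p , n%ℕd<d x p , ≈-trans (^-cong m (%ℕ-≈ x)) xᵐ≈c)
    (ℕ.anyUpTo? (λ r → ≈? ((+ r) ^ m) c) p)

  IsPower-* : ∀ m {c d} → IsPower m c → IsPower m d → IsPower m (c * d)
  IsPower-* m (x , xᵐ≈c) (y , yᵐ≈d) = x * y , ≈-trans (≈-reflexive (^-distribʳ-* x y m)) (*-cong xᵐ≈c yᵐ≈d)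

  IsPower-square : ∀ m {c} → IsPower m c → IsPower (2 ℕ.* m) (c * c)
  IsPower-square m (x , xᵐ≈c) = x , ≈-trans (≈-reflexive (^-double x m)) (*-cong xᵐ≈c xᵐ≈c)

  IsPower-*ˡ⇒ : ∀ k m {c} → IsPower (k ℕ.* m) c → IsPower m c
  IsPower-*ˡ⇒ k m (x , x^km≈c) = x ^ k , ≈-trans (≈-reflexive (ℤ.^-*-assoc x k m)) x^km≈c

module PrimeModulus (p : ℕ) (prime : Prime p) where
  open Congruence p

  instance
    p≢0 : NonZero p
    p≢0 = prime⇒nonZero prime

  ∣*⇒∣⊎∣ : ∀ x y → p ∣ ∣ x * y ∣ → (p ∣ ∣ x ∣) ⊎ (p ∣ ∣ y ∣)
  ∣*⇒∣⊎∣ x y p∣xy = euclidsLemma ∣ x ∣ ∣ y ∣ prime (subst (p ∣_) (ℤ.abs-* x y) p∣xy)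

  ∤-* : ∀ {x y} → p ∤ ∣ x ∣ → p ∤ ∣ y ∣ → p ∤ ∣ x * y ∣
  ∤-* {x} {y} p∤x p∤y p∣xy = [ p∤x , p∤y ]′ (∣*⇒∣⊎∣ x y p∣xy)

  ∣⇒∣^ : ∀ {w} m .{{_ : NonZero m}} → p ∣ ∣ w ∣ → p ∣ ∣ w ^ m ∣
  ∣⇒∣^ {w} (suc m) p∣w = subst (p ∣_) (sym (ℤ.abs-* w (w ^ m))) (ℕ.∣m⇒∣m*n ∣ w ^ m ∣ p∣w)

  *-cancelˡ-≈ : ∀ c {x y} → p ∤ ∣ c ∣ → c * x ≈ c * y → x ≈ y
  *-cancelˡ-≈ c {x} {y} p∤c (mk≈ p∣cx-cy) =
    mk≈ ([ (λ p∣c → contradiction p∣c p∤c) , id ]′ (∣*⇒∣⊎∣ c (x - y) (subst (λ t → p ∣ ∣ t ∣) (factor c x y) p∣cx-cy)))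
    where
    factor : ∀ c x y → c * x - c * y ≡ c * (x - y)
    factor = solve-∀

  ∤⇒coprime : ∀ {m} → p ∤ m → Coprime p m
  ∤⇒coprime p∤m (d∣p , d∣m) with prime⇒irreducible prime d∣p
  ... | inj₁ d≡1 = d≡1
  ... | inj₂ refl = contradiction d∣m p∤m

  Bézout⇒inverse : ∀ {m} → Bézout.Identity 1 p m → ∃[ v ] (+ m * v ≈ 1ℤ)
  Bézout⇒inverse {m} (Bézout.+- x y eq) = - + y , ∣ₛ⇒≈ (ℤ.divides (- + x) (begin
    + m * - + y - 1ℤ   ≡⟨ rearrange (+ m) (+ y) ⟩
    - (1ℤ + + y * + m) ≡⟨ cong -_ (pos-1+*-≡ y m x p eq) ⟩
    - (+ x * + p)       ≡⟨ ℤ.neg-distribˡ-* (+ x) (+ p) ⟩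
    - + x * + p         ∎))
    where
    open ≡-Reasoning
    rearrange : ∀ m y → m * - y - 1ℤ ≡ - (1ℤ + y * m)
    rearrange = solve-∀
  Bézout⇒inverse {m} (Bézout.-+ x y eq) = + y , ∣ₛ⇒≈ (ℤ.divides (+ x) (begin
    + m * + y - 1ℤ       ≡⟨ cong (_- 1ℤ) (ℤ.*-comm (+ m) (+ y)) ⟩
    + y * + m - 1ℤ       ≡⟨ cong (_- 1ℤ) (pos-1+*-≡ x p y m eq) ⟨
    1ℤ + + x * + p - 1ℤ   ≡⟨ cancel (+ x * + p) ⟩
    + x * + p             ∎))
    where
    open ≡-Reasoning
    cancel : ∀ z → 1ℤ + z - 1ℤ ≡ z
    cancel = solve-∀

  inverse : ∀ {w} → p ∤ ∣ w ∣ → ∃[ v ] (w * v ≈ 1ℤ)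
  inverse {w} p∤w with ℤ.+∣i∣≡i⊎+∣i∣≡-i w | Bézout⇒inverse (coprime-Bézout (∤⇒coprime p∤w))
  ... | inj₁ ∣w∣≡w | v , ∣w∣v≈1 = v , subst (λ t → t * v ≈ 1ℤ) ∣w∣≡w ∣w∣v≈1
  ... | inj₂ ∣w∣≡-w | v , ∣w∣v≈1 = - v , ≈-trans (≈-reflexive (begin
      w * - v     ≡⟨ ℤ.neg-distribʳ-* w v ⟨
      - (w * v)   ≡⟨ ℤ.neg-distribˡ-* w v ⟩
      - w * v     ≡⟨ cong (_* v) ∣w∣≡-w ⟨
      + ∣ w ∣ * v ∎)) ∣w∣v≈1
    where open ≡-Reasoning

  IsPower-cancelʳ : ∀ m {c} d .{{_ : NonZero m}} → p ∤ ∣ d ∣ →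
                    IsPower m (c * d) → IsPower m d → IsPower m c
  IsPower-cancelʳ m {c} d p∤d (z , zᵐ≈cd) (w , wᵐ≈d) =
    let v , wv≈1 = inverse {w} (λ p∣w → p∤d (∣-resp-≈ wᵐ≈d (∣⇒∣^ m p∣w)))
    in z * v , (begin
      (z * v) ^ m           ≡⟨ ^-distribʳ-* z v m ⟩
      z ^ m * v ^ m         ≈⟨ *-congʳ (v ^ m) zᵐ≈cd ⟩
      c * d * v ^ m         ≈⟨ *-congʳ (v ^ m) (*-congˡ c (≈-sym wᵐ≈d)) ⟩
      c * w ^ m * v ^ m     ≡⟨ ℤ.*-assoc c (w ^ m) (v ^ m) ⟩
      c * (w ^ m * v ^ m)   ≡⟨ cong (c *_) (^-distribʳ-* w v m) ⟨
      c * (w * v) ^ m       ≈⟨ *-congˡ c (^-cong m wv≈1) ⟩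
      c * 1ℤ ^ m            ≡⟨ cong (c *_) (ℤ.^-zeroˡ m) ⟩
      c * 1ℤ                ≡⟨ ℤ.*-identityʳ c ⟩
      c                     ∎)
    where open ≈-Reasoning

module IndexTwo (p : ℕ) (prime : Prime p) (e : ℕ) .{{_ : NonZero e}} where
  open Congruence p
  open PrimeModulus p prime
  open Counting

  instance
    2*e≢0 : NonZero (2 ℕ.* e)
    2*e≢0 = ℕ.m*n≢0 2 e

  UnitPower : ℕ → Pred ℕ 0ℓ
  UnitPower m r = p ∤ r × IsPower m (+ r)

  UnitPower? : ∀ m → Decidable (UnitPower m)
  UnitPower? m r = ¬? (p ∣? r) ×-dec IsPower? m (+ r)

  H K : Pred ℕ 0ℓ
  H = UnitPower e
  K = UnitPower (2 ℕ.* e)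

  H? : Decidable H
  H? = UnitPower? e

  K? : Decidable K
  K? = UnitPower? (2 ℕ.* e)

  K⊆H : ∀ {r} → K r → H r
  K⊆H (p∤r , r-power) = p∤r , IsPower-*ˡ⇒ 2 e r-power

  ∤⇒>0 : ∀ {r} → p ∤ r → 0 < r
  ∤⇒>0 p∤r = ℕ.n≢0⇒n>0 λ { refl → p∤r (p ∣0) }

  square : ℕ → ℕ
  square r = (+ r * + r) %ℕ p

  square-maps : ∀ {r} → H r → square r < p × K (square r)
  square-maps {r} (p∤r , r-power) =
    n%ℕd<d (+ r * + r) p , (λ p∣r² → ∤-* {+ r} {+ r} p∤r p∤r (∣-resp-≈ (%ℕ-≈ (+ r * + r)) p∣r²)) ,
    IsPower-resp (2 ℕ.* e) (≈-sym (%ℕ-≈ (+ r * + r))) (IsPower-square e r-power)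

  square-≡ : ∀ {i j} → i < p → j < p → p ∤ i → square i ≡ square j → i ≡ j ⊎ i ℕ.+ j ≡ p
  square-≡ {i} {j} i<p j<p p∤i eq =
    Sum.map (λ p∣i-j → +≈+⇒≡ i<p j<p (mk≈ p∣i-j)) (∣+⇒+≡ (∤⇒>0 p∤i) i<p j<p)
      (∣*⇒∣⊎∣ (+ i - + j) (+ i + + j) (subst (λ t → p ∣ ∣ t ∣) (factor (+ i) (+ j)) (≈⇒≡mod i²≈j²)))
    where
    i²≈j² : + i * + i ≈ + j * + j
    i²≈j² = ≈-trans (≈-sym (%ℕ-≈ (+ i * + i))) (≈-trans (≈-reflexive (cong +_ eq)) (%ℕ-≈ (+ j * + j)))
    factor : ∀ i j → i * i - j * j ≡ (i - j) * (i + j)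
    factor = solve-∀

  -- r and p - r have the same square; Low separates them.
  Low : Pred ℕ 0ℓ
  Low r = r ℕ.+ r < p

  square-injective-Low : ∀ {i j} → i < p → j < p → p ∤ i → Low i → Low j → square i ≡ square j → i ≡ j
  square-injective-Low {i} {j} i<p j<p p∤i low-i low-j eq = [ id , too-small ]′ (square-≡ i<p j<p p∤i eq)
    where
    too-small : i ℕ.+ j ≡ p → i ≡ j
    too-small i+j≡p = contradiction (ℕ.+-mono-< low-i low-j)
      (ℕ.≤⇒≯ (ℕ.≤-reflexive (trans (sym (cong₂ ℕ._+_ i+j≡p i+j≡p)) (shuffle i j))))
      where
      shuffle : ∀ i j → (i ℕ.+ j) ℕ.+ (i ℕ.+ j) ≡ (i ℕ.+ i) ℕ.+ (j ℕ.+ j)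
      shuffle = ℕSolver.solve-∀

  square-injective-High : ∀ {i j} → i < p → j < p → p ∤ i → ¬ Low i → ¬ Low j → square i ≡ square j → i ≡ j
  square-injective-High {i} {j} i<p j<p p∤i high-i high-j eq = [ id , balanced ]′ (square-≡ i<p j<p p∤i eq)
    where
    balanced : i ℕ.+ j ≡ p → i ≡ j
    balanced i+j≡p = ℕ.≤-antisym
      (ℕ.+-cancelʳ-≤ j i j (subst (_≤ j ℕ.+ j) (sym i+j≡p) (ℕ.≮⇒≥ high-j)))
      (ℕ.+-cancelˡ-≤ i j i (subst (_≤ i ℕ.+ i) (sym i+j≡p) (ℕ.≮⇒≥ high-i)))

  count-H≤2*count-K : count H? p ≤ count K? p ℕ.+ count K? p
  count-H≤2*count-K = begin
    count H? p                                                ≡⟨ count-split H? Low? p ⟩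
    count (H? ∩? Low?) p ℕ.+ count (H? ∩? ∁? Low?) p          ≤⟨ ℕ.+-mono-≤
      (injective⇒count≤ (H? ∩? Low?) K? square (λ _ → square-maps ∘ proj₁)
        (λ i<p j<p (Hi , low-i) (_ , low-j) → square-injective-Low i<p j<p (proj₁ Hi) low-i low-j))
      (injective⇒count≤ (H? ∩? ∁? Low?) K? square (λ _ → square-maps ∘ proj₁)
        (λ i<p j<p (Hi , high-i) (_ , high-j) → square-injective-High i<p j<p (proj₁ Hi) high-i high-j)) ⟩
    count K? p ℕ.+ count K? p                                 ∎
    where
    open ℕ.≤-Reasoning
    Low? : Decidable Low
    Low? r = r ℕ.+ r ℕ.<? p

  multiply : ℤ → ℕ → ℕ
  multiply c r = (c * + r) %ℕ p

  multiply-injective : ∀ c {i j} → p ∤ ∣ c ∣ → i < p → j < p → multiply c i ≡ multiply c j → i ≡ j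
  multiply-injective c {i} {j} p∤c i<p j<p eq = +≈+⇒≡ i<p j<p (*-cancelˡ-≈ c p∤c (begin
    c * + i            ≈⟨ %ℕ-≈ (c * + i) ⟨
    + multiply c i     ≡⟨ cong +_ eq ⟩
    + multiply c j     ≈⟨ %ℕ-≈ (c * + j) ⟩
    c * + j            ∎))
    where open ≈-Reasoning

  multiply-maps : ∀ c {r} → p ∤ ∣ c ∣ → IsPower e c → ¬ IsPower (2 ℕ.* e) c → K r →
                  multiply c r < p × (H (multiply c r) × ¬ K (multiply c r))
  multiply-maps c {r} p∤c c-power c-nonpower (p∤r , r-power) =
    n%ℕd<d (c * + r) p ,
    ((λ p∣cr → ∤-* {c} {+ r} p∤c p∤r (∣-resp-≈ (%ℕ-≈ (c * + r)) p∣cr)) ,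
      IsPower-resp e (≈-sym (%ℕ-≈ (c * + r))) (IsPower-* e c-power (IsPower-*ˡ⇒ 2 e r-power))) ,
    λ (_ , cr-power) → c-nonpower (IsPower-cancelʳ (2 ℕ.* e) (+ r) p∤r
      (IsPower-resp (2 ℕ.* e) (%ℕ-≈ (c * + r)) cr-power) r-power)

  Coset : ℤ → Pred ℕ 0ℓ
  Coset c r = ∃ λ k → k < p × K k × c * + k ≈ + r

  Coset? : ∀ c → Decidable (Coset c)
  Coset? c r = ℕ.anyUpTo? (λ k → K? k ×-dec ≈? (c * + k) (+ r)) p

  multiply-∉-Coset : ∀ {a b i} → IsPower e a → ¬ IsPower (2 ℕ.* e) (a * b) → K i →
                     ¬ Coset a (multiply b i)
  multiply-∉-Coset {a} {b} {i} a-power ab-nonpower (p∤i , i-power) (k , _ , (_ , k-power) , ak≈bi) =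
    ab-nonpower (IsPower-cancelʳ (2 ℕ.* e) (+ i) p∤i
      (IsPower-resp (2 ℕ.* e) a²k≈abi (IsPower-* (2 ℕ.* e) (IsPower-square e a-power) k-power)) i-power)
    where
    a²k≈abi : a * a * + k ≈ a * b * + i
    a²k≈abi = begin
      a * a * + k         ≡⟨ ℤ.*-assoc a a (+ k) ⟩
      a * (a * + k)       ≈⟨ *-congˡ a ak≈bi ⟩
      a * + multiply b i  ≈⟨ *-congˡ a (%ℕ-≈ (b * + i)) ⟩
      a * (b * + i)       ≡⟨ ℤ.*-assoc a b (+ i) ⟨
      a * b * + i         ∎
      where open ≈-Reasoning

  3*count-K≤count-H : ∀ {a b} → p ∤ ∣ a ∣ → p ∤ ∣ b ∣ → IsPower e a → IsPower e b →
                      ¬ IsPower (2 ℕ.* e) a → ¬ IsPower (2 ℕ.* e) b → ¬ IsPower (2 ℕ.* e) (a * b) →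
                      count K? p ℕ.+ (count K? p ℕ.+ count K? p) ≤ count H? p
  3*count-K≤count-H {a} {b} p∤a p∤b a-power b-power a-nonpower b-nonpower ab-nonpower = begin
    count K? p ℕ.+ (count K? p ℕ.+ count K? p)
      ≤⟨ ℕ.+-mono-≤ K≤H∩K (ℕ.+-mono-≤ aK≤H∖K∩aK bK≤H∖K∖aK) ⟩
    count (H? ∩? K?) p ℕ.+ (count (H∖K? ∩? Coset? a) p ℕ.+ count (H∖K? ∩? ∁? (Coset? a)) p)
      ≡⟨ cong (count (H? ∩? K?) p ℕ.+_) (count-split H∖K? (Coset? a) p) ⟨
    count (H? ∩? K?) p ℕ.+ count H∖K? p
      ≡⟨ count-split H? K? p ⟨
    count H? p ∎
    where
    open ℕ.≤-Reasoning
    H∖K? : Decidable (H ∩ ∁ K)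
    H∖K? = H? ∩? ∁? K?
    K≤H∩K : count K? p ≤ count (H? ∩? K?) p
    K≤H∩K = count-mono K? (H? ∩? K?) {p} (λ _ Kr → K⊆H Kr , Kr)
    aK≤H∖K∩aK : count K? p ≤ count (H∖K? ∩? Coset? a) p
    aK≤H∖K∩aK = injective⇒count≤ K? (H∖K? ∩? Coset? a) (multiply a)
      (λ {k} k<p Kk → let ak<p , H-ak , ¬K-ak = multiply-maps a p∤a a-power a-nonpower Kk
                       in ak<p , (H-ak , ¬K-ak) , (k , k<p , Kk , ≈-sym (%ℕ-≈ (a * + k))))
      (λ i<p j<p _ _ → multiply-injective a p∤a i<p j<p)
    bK≤H∖K∖aK : count K? p ≤ count (H∖K? ∩? ∁? (Coset? a)) p
    bK≤H∖K∖aK = injective⇒count≤ K? (H∖K? ∩? ∁? (Coset? a)) (multiply b)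
      (λ i<p Ki → let bi<p , H-bi , ¬K-bi = multiply-maps b p∤b b-power b-nonpower Ki
                   in bi<p , (H-bi , ¬K-bi) , multiply-∉-Coset a-power ab-nonpower Ki)
      (λ i<p j<p _ _ → multiply-injective b p∤b i<p j<p)

  count-K>0 : 0 < count K? p
  count-K>0 = count-pos K? 1<p (ℕ.>⇒≢ 1<p ∘ ∣1⇒≡1 , 1ℤ , ≈-reflexive (ℤ.^-zeroˡ (2 ℕ.* e)))
    where
    1<p : 1 < p
    1<p = ℕ.nonTrivial⇒n>1 p {{prime⇒nonTrivial prime}}

  *-IsPower : ∀ {a b} → p ∤ ∣ a ∣ → p ∤ ∣ b ∣ → IsPower e a → IsPower e b →
              ¬ IsPower (2 ℕ.* e) a → ¬ IsPower (2 ℕ.* e) b → IsPower (2 ℕ.* e) (a * b)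
  *-IsPower {a} {b} p∤a p∤b a-power b-power a-nonpower b-nonpower =
    decidable-stable (IsPower? (2 ℕ.* e) (a * b)) λ ab-nonpower →
      ℕ.<⇒≱ count-K>0 (ℕ.+-cancelʳ-≤ (count K? p ℕ.+ count K? p) (count K? p) 0 (ℕ.≤-trans
        (3*count-K≤count-H p∤a p∤b a-power b-power a-nonpower b-nonpower ab-nonpower)
        count-H≤2*count-K))

IsRes-resp : ∀ p k {a b} → a ≡ b [mod p ] → IsRes k a p ⇔ IsRes k b p
IsRes-resp p k a≡b = mk⇔ (transport (mk≈ a≡b)) (transport (≈-sym (mk≈ a≡b)))
  where
  open Congruence p
  transport : ∀ {a b} → a ≈ b → IsRes k a p → IsRes k b p
  transport a≈b (x , xᵏ≡a) = x , ≈⇒≡mod (≈-trans (mk≈ {x ^ (2 ℕ.^ k)} xᵏ≡a) a≈b)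

IsRes-*⇔ : ∀ {p} j {a b} → Prime p → p ∤ ∣ a ∣ → p ∤ ∣ b ∣ → IsRes j a p → IsRes j b p →
           IsRes (suc j) (a * b) p ⇔ (IsRes (suc j) a p ⇔ IsRes (suc j) b p)
IsRes-*⇔ {p} j {a} {b} p-prime p∤a p∤b (x , xᵉ≡a) (y , yᵉ≡b) = mk⇔
  (λ ab-res → mk⇔
    (λ a-res → fromPower (IsPower-cancelʳ (2 ℕ.* e) a p∤a
      (IsPower-resp (2 ℕ.* e) (≈-reflexive (ℤ.*-comm a b)) (toPower ab-res)) (toPower a-res)))
    (λ b-res → fromPower (IsPower-cancelʳ (2 ℕ.* e) b p∤b (toPower ab-res) (toPower b-res))))
  (λ a⇔b → fromPower (both-or-neither a⇔b (IsPower? (2 ℕ.* e) a)))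
  where
  open Congruence p
  open PrimeModulus p p-prime
  e : ℕ
  e = 2 ℕ.^ j
  instance
    e≢0 : NonZero e
    e≢0 = ℕ.m^n≢0 2 j
  open IndexTwo p p-prime e
  -- 2 ^ suc j reduces to 2 * e, so these only unwrap the record _≈_.
  toPower : ∀ {c} → IsRes (suc j) c p → IsPower (2 ℕ.* e) c
  toPower (z , zᵐ≡c) = z , mk≈ zᵐ≡c
  fromPower : ∀ {c} → IsPower (2 ℕ.* e) c → IsRes (suc j) c p
  fromPower (z , zᵐ≈c) = z , ≈⇒≡mod zᵐ≈c
  both-or-neither : IsRes (suc j) a p ⇔ IsRes (suc j) b p → Dec (IsPower (2 ℕ.* e) a) → IsPower (2 ℕ.* e) (a * b)
  both-or-neither a⇔b (yes a-res) = IsPower-* (2 ℕ.* e) a-res (toPower (Equivalence.to a⇔b (fromPower a-res)))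
  both-or-neither a⇔b (no a-nonres) = *-IsPower p∤a p∤b (x , mk≈ xᵉ≡a) (y , mk≈ yᵉ≡b) a-nonres
    (λ b-res → a-nonres (toPower (Equivalence.from a⇔b (fromPower b-res))))

SymP-resp : ∀ {k a b p s t} → IsRes k a p ⇔ IsRes k b p → SymP k a p s → SymP k b p t → s ≡ t
SymP-resp a⇔b (inj₁ (refl , _)) (inj₁ (refl , _)) = refl
SymP-resp a⇔b (inj₁ (refl , a-res)) (inj₂ (refl , b-nonres)) = contradiction (Equivalence.to a⇔b a-res) b-nonres
SymP-resp a⇔b (inj₂ (refl , a-nonres)) (inj₁ (refl , b-res)) = contradiction (Equivalence.from a⇔b b-res) a-nonres
SymP-resp a⇔b (inj₂ (refl , _)) (inj₂ (refl , _)) = refl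

SymP-* : ∀ {k a b c p s t u} → IsRes k c p ⇔ (IsRes k a p ⇔ IsRes k b p) →
         SymP k c p u → SymP k a p s → SymP k b p t → u ≡ s * t
SymP-* c⇔ (inj₁ (refl , _)) (inj₁ (refl , _)) (inj₁ (refl , _)) = refl
SymP-* c⇔ (inj₁ (refl , c-res)) (inj₁ (refl , a-res)) (inj₂ (refl , b-nonres)) =
  contradiction (Equivalence.to (Equivalence.to c⇔ c-res) a-res) b-nonres
SymP-* c⇔ (inj₁ (refl , c-res)) (inj₂ (refl , a-nonres)) (inj₁ (refl , b-res)) =
  contradiction (Equivalence.from (Equivalence.to c⇔ c-res) b-res) a-nonres
SymP-* c⇔ (inj₁ (refl , _)) (inj₂ (refl , _)) (inj₂ (refl , _)) = refl
SymP-* c⇔ (inj₂ (refl , c-nonres)) (inj₁ (refl , a-res)) (inj₁ (refl , b-res)) =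
  contradiction (Equivalence.from c⇔ (mk⇔ (λ _ → b-res) (λ _ → a-res))) c-nonres
SymP-* c⇔ (inj₂ (refl , _)) (inj₁ (refl , _)) (inj₂ (refl , _)) = refl
SymP-* c⇔ (inj₂ (refl , _)) (inj₂ (refl , _)) (inj₁ (refl , _)) = refl
SymP-* c⇔ (inj₂ (refl , c-nonres)) (inj₂ (refl , a-nonres)) (inj₂ (refl , b-nonres)) =
  contradiction (Equivalence.from c⇔ (mk⇔ (flip contradiction a-nonres) (flip contradiction b-nonres))) c-nonres

SymL-resp : ∀ {k a b} ps → All (λ p → IsRes k a p ⇔ IsRes k b p) ps →
            ∀ {s t} → SymL k a ps s → SymL k b ps t → s ≡ t
SymL-resp [] [] refl refl = refl
SymL-resp {k} {a} {b} (p ∷ ps) (a⇔b ∷ a⇔b-rest) (_ , _ , sp , sl , refl) (_ , _ , tp , tl , refl) =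
  cong₂ _*_ (SymP-resp {k} {a} {b} a⇔b sp tp) (SymL-resp ps a⇔b-rest sl tl)

SymL-* : ∀ {k a b c} ps → All (λ p → IsRes k c p ⇔ (IsRes k a p ⇔ IsRes k b p)) ps →
         ∀ {s t u} → SymL k c ps u → SymL k a ps s → SymL k b ps t → u ≡ s * t
SymL-* [] [] refl refl refl = refl
SymL-* {k} {a} {b} {c} (p ∷ ps) (c⇔ ∷ c⇔-rest)
  (u₁ , u₂ , up , ul , refl) (s₁ , s₂ , sp , sl , refl) (t₁ , t₂ , tp , tl , refl) = begin
    u₁ * u₂               ≡⟨ cong₂ _*_ (SymP-* {k} {a} {b} {c} c⇔ up sp tp) (SymL-* ps c⇔-rest ul sl tl) ⟩
    (s₁ * t₁) * (s₂ * t₂) ≡⟨ interchange s₁ t₁ s₂ t₂ ⟩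
    (s₁ * s₂) * (t₁ * t₂) ∎
  where
  open ≡-Reasoning
  interchange : ∀ a b c d → (a * b) * (c * d) ≡ (a * c) * (b * d)
  interchange = solve-∀

∤∣ab∣⇒∤∣a∣×∤∣b∣ : ∀ {p} a b → p ∤ ∣ a * b ∣ → p ∤ ∣ a ∣ × p ∤ ∣ b ∣
∤∣ab∣⇒∤∣a∣×∤∣b∣ {p} a b p∤ab =
  (λ p∣a → p∤ab (subst (p ∣_) (sym (ℤ.abs-* a b)) (ℕ.∣m⇒∣m*n ∣ b ∣ p∣a))) ,
  (λ p∣b → p∤ab (subst (p ∣_) (sym (ℤ.abs-* a b)) (ℕ.∣n⇒∣m*n ∣ a ∣ p∣b)))

gcd≡1⇒∤ : ∀ {p n m} → Prime p → p ∣ n → gcd n m ≡ 1 → p ∤ m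
gcd≡1⇒∤ p-prime p∣n gcd≡1 p∣m = ℕ.>⇒≢ (ℕ.nonTrivial⇒n>1 _ {{prime⇒nonTrivial p-prime}})
  (ℕ.∣1⇒≡1 (subst (_ ∣_) gcd≡1 (gcd-greatest p∣n p∣m)))

lemma1 : (n : ℕ) (a b : ℤ) → gcd n ∣ a * b ∣ ≡ 1 →
           (ps : List ℕ) → IsPrimeFactorization ps n →
           ((a ≡ b [mod n ]) → ∀ (k : ℕ) (s t : ℤ) →
              SymL k a ps s → SymL k b ps t → s ≡ t)
           × (∀ (j : ℕ) →
              (∀ (p : ℕ) → Prime p → p ∣ n → IsRes j a p × IsRes j b p) →
              ∀ (s t u : ℤ) → SymL (suc j) (a * b) ps u →
                SymL (suc j) a ps s → SymL (suc j) b ps t → u ≡ s * t)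
lemma1 n a b gcd≡1 ps (primes , ∏ps≡n) = part₁ , part₂
  where
  atPrimeFactors : {P : ℕ → Set} → (∀ {p} → Prime p → p ∣ n → P p) → All P ps
  atPrimeFactors f = All.tabulate λ p∈ps → f (All.lookup primes p∈ps) (subst (_ ∣_) ∏ps≡n (∈⇒∣product p∈ps))
  part₁ : a ≡ b [mod n ] → ∀ k s t → SymL k a ps s → SymL k b ps t → s ≡ t
  part₁ a≡b k _ _ = SymL-resp ps (atPrimeFactors λ {p} _ p∣n → IsRes-resp p k (ℕ.∣-trans p∣n a≡b))
  part₂ : ∀ j → (∀ p → Prime p → p ∣ n → IsRes j a p × IsRes j b p) →
          ∀ s t u → SymL (suc j) (a * b) ps u → SymL (suc j) a ps s → SymL (suc j) b ps t → u ≡ s * t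
  part₂ j residues _ _ _ = SymL-* ps (atPrimeFactors λ {p} p-prime p∣n →
    let p∤a , p∤b = ∤∣ab∣⇒∤∣a∣×∤∣b∣ a b (gcd≡1⇒∤ p-prime p∣n gcd≡1)
        a-res , b-res = residues p p-prime p∣n
    in IsRes-*⇔ j p-prime p∤a p∤b a-res b-res)
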